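{- Let $G$ be a finite simple cubic (3-regular) graph that is Hamiltonian and bipartite, of order $2m$, and suppose $G$ has symmetry factor $b \in \mathbb{N}$ (in the sense defined in the context). If $G$ has girth $g$, then $b \ge g/4 - 1/2$.
   Context: All graphs are finite, simple and undirected; the girth is the length of a shortest cycle. A Hamiltonian cubic bipartite graph $G$ of order $2m$ is said to have symmetry factor $b \in \mathbb{N}$ if (1) $b$ divides $m$, and (2) there is a labelling of the vertices of $G$ by $1, 2, \ldots, 2m$ such that $1 \to 2 \to \cdots \to 2m \to 1$ is a Hamiltonian cycle of $G$ and, writing $u_i$ for the unique neighbour of vertex $i$ not adjacent to it along this Hamiltonian cycle ($1 \le i \le 2m$), the following holds: whenever $1 \le i \le 2m$, $1 \le j \le 2b$ and $j \equiv i \pmod{2b}$, we have $u_i - i \equiv u_j - j \pmod{2m}$. -}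

module Defs where

open import Data.Nat using (ℕ; zero; suc; _+_; _*_; _≤_; _<_)
open import Data.Nat.Divisibility using (_∣_)
open import Data.Fin using (Fin; zero; suc; toℕ)
open import Data.Bool using (Bool)
open import Data.Product using (Σ; ∃; _×_; _,_)
open import Data.Sum using (_⊎_)
open import Relation.Binary.PropositionalEquality using (_≡_; _≢_)
open import Relation.Nullary using (¬_)
open import Function.Definitions using (Injective; Bijective)
open import Level using (0ℓ)

record Graph (n : ℕ) : Set₁ where
  field
    Adj     : Fin n → Fin n → Set
    sym     : ∀ {x y} → Adj x y → Adj y x
    irrefl  : ∀ {x} → ¬ Adj x x
open Graph public

cnext : ∀ {n} → Fin n → Fin n
cnext {suc zero} zero = zero
cnext {suc (suc n)} zero = suc zero
cnext {suc (suc n)} (suc i) with cnext {suc n} i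
... | zero  = zero
... | suc k = suc (suc k)

Cubic : ∀ {n} → Graph n → Set
Cubic G = ∀ v → Σ (Fin _) λ a → Σ (Fin _) λ b → Σ (Fin _) λ c →
  (a ≢ b) × (a ≢ c) × (b ≢ c) ×
  Adj G v a × Adj G v b × Adj G v c ×
  (∀ w → Adj G v w → (w ≡ a) ⊎ (w ≡ b) ⊎ (w ≡ c))

Bipartite : ∀ {n} → Graph n → Set
Bipartite {n} G = Σ (Fin n → Bool) λ col → ∀ {x y} → Adj G x y → col x ≢ col y

IsHamCycle : ∀ {n} → Graph n → (Fin n → Fin n) → Set
IsHamCycle {n} G f = 3 ≤ n × Bijective _≡_ _≡_ f × (∀ i → Adj G (f i) (f (cnext i)))

Hamiltonian : ∀ {n} → Graph n → Set
Hamiltonian {n} G = Σ (Fin n → Fin n) λ f → IsHamCycle G f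

IsCycle : ∀ {n} → Graph n → (k : ℕ) → (Fin k → Fin n) → Set
IsCycle G k c = 3 ≤ k × Injective _≡_ _≡_ c × (∀ i → Adj G (c i) (c (cnext i)))

HasGirth : ∀ {n} → Graph n → ℕ → Set
HasGirth {n} G g =
  Σ (Fin g → Fin n) (λ c → IsCycle G g c) ×
  (∀ k (c : Fin k → Fin n) → IsCycle G k c → g ≤ k)

-- Congruence of natural numbers modulo q (q = 0 gives equality).
_≡_[mod_] : ℕ → ℕ → ℕ → Set
x ≡ y [mod q ] = ∃ λ t → (x + t * q ≡ y) ⊎ (y + t * q ≡ x)

-- With labelling f (f i = vertex carrying label i, labels 0-based), u is the
-- chord partner u_i of i: adjacent to i but not i ± 1 along the cycle.
IsChord : ∀ {n} → Graph n → (Fin n → Fin n) → Fin n → Fin n → Set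
IsChord G f i u = Adj G (f i) (f u) × (u ≢ cnext i) × (cnext u ≢ i)

HasSymmetryFactor : (m : ℕ) → Graph (2 * m) → ℕ → Set
HasSymmetryFactor m G b =
  (b ∣ m) ×
  Σ (Fin (2 * m) → Fin (2 * m)) λ f →
    IsHamCycle G f ×
    (∀ i j u v → toℕ j < 2 * b → toℕ i ≡ toℕ j [mod 2 * b ] →
       IsChord G f i u → IsChord G f j v →
       (toℕ u + toℕ j) ≡ (toℕ v + toℕ i) [mod 2 * m ])

module Submission where

-- Label the vertices 0, 1, …, N-1 along the Hamiltonian cycle of the
-- symmetry-factor labelling and put B = 2b.  Vertex 0 has a chord to some
-- label d with 2 ≤ d ≤ N-2.  Three cases:
--   * d ≤ B + 1:      the chord closes the arc 0, 1, …, d       (length d + 1);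
--   * N - d ≤ B + 1:  it closes the arc d, d+1, …, N-1, 0       (length N - d + 1);
--   * otherwise B < d and d + B < N.  Since B ≡ 0 (mod 2b), the symmetry
--     factor makes the chord at label B the translate of the chord at 0, so it
--     ends at d + B, and the two chords join the arcs 0, …, B and d, …, d + B
--     into a "ladder" cycle of length 2B + 2.
-- In every case there is a cycle of length at most 2B + 2 = 4b + 2.

open import Defs hiding (sym)
open Graph using () renaming (sym to adj-sym)
open import Data.Nat using (ℕ; zero; suc; _+_; _*_; _∸_; _≤_; _<_; _≤?_; z≤n; s≤s)
open import Data.Nat.Properties
open import Data.Nat.DivMod using (_%_; _mod_; m<n⇒m%n≡m; n%n≡0)
open import Data.Nat.Divisibility using (0∣⇒≡0)
open import Data.Nat.Tactic.RingSolver using (solve-∀)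
open import Data.Fin using (Fin; zero; suc; toℕ)
open import Data.Fin.Properties using (toℕ-injective; toℕ<n; toℕ-fromℕ<) renaming (_≟_ to _≟ᶠ_)
open import Data.Product using (Σ; ∃; _×_; _,_; proj₁; proj₂)
open import Data.Sum using (_⊎_; inj₁; inj₂)
open import Data.Empty using (⊥; ⊥-elim)
open import Function using (_∘_)
open import Function.Definitions using (Injective)
open import Relation.Nullary using (¬_; Dec; yes; no)
open import Relation.Nullary.Decidable using (_⊎-dec_)
open import Relation.Binary.Definitions using (DecidableEquality)
open import Relation.Binary.PropositionalEquality

multiple≤ : ∀ {N x y} t → x + suc t * N ≡ y → N ≤ y
multiple≤ {N} {x} t e = ≤-trans (≤-trans (m≤m+n N (t * N)) (m≤n+m _ x)) (≤-reflexive e)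

mod-unique : ∀ {N x y} → x < N → y < N → x ≡ y [mod N ] → x ≡ y
mod-unique _ _ (zero , inj₁ x≡y) = trans (sym (+-identityʳ _)) x≡y
mod-unique _ _ (zero , inj₂ y≡x) = sym (trans (sym (+-identityʳ _)) y≡x)
mod-unique {x = x} _ y<N (suc t , inj₁ e) = ⊥-elim (<⇒≱ y<N (multiple≤ {x = x} t e))
mod-unique {y = y} x<N _ (suc t , inj₂ e) = ⊥-elim (<⇒≱ x<N (multiple≤ {x = y} t e))

%-injective-below : ∀ {n x y} → x < suc n → y < suc n → x % suc n ≡ y % suc n → x ≡ y
%-injective-below x<N y<N e = trans (sym (m<n⇒m%n≡m x<N)) (trans e (m<n⇒m%n≡m y<N))

%-positive : ∀ {n x} → 1 ≤ x → x < suc n → x % suc n ≢ suc n % suc n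
%-positive {n} 1≤x x<N e = <⇒≱ 1≤x (≤-reflexive (trans (sym (m<n⇒m%n≡m x<N)) (trans e (n%n≡0 (suc n)))))

%-injective-positive : ∀ {n x y} → 1 ≤ x → x ≤ suc n → 1 ≤ y → y ≤ suc n →
  x % suc n ≡ y % suc n → x ≡ y
%-injective-positive 1≤x x≤N 1≤y y≤N e with m≤n⇒m<n∨m≡n x≤N | m≤n⇒m<n∨m≡n y≤N
... | inj₁ x<N | inj₁ y<N = %-injective-below x<N y<N e
... | inj₁ x<N | inj₂ refl = ⊥-elim (%-positive 1≤x x<N e)
... | inj₂ refl | inj₁ y<N = ⊥-elim (%-positive 1≤y y<N (sym e))
... | inj₂ refl | inj₂ refl = refl

cnext-toℕ : ∀ {n} (i : Fin (suc n)) →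
  (toℕ i < n × toℕ (cnext i) ≡ suc (toℕ i)) ⊎ (toℕ i ≡ n × cnext i ≡ zero)
cnext-toℕ {zero} zero = inj₂ (refl , refl)
cnext-toℕ {suc n} zero = inj₁ (s≤s z≤n , refl)
cnext-toℕ {suc n} (suc i) with cnext i | cnext-toℕ i
... | zero  | inj₁ (_ , ())
... | zero  | inj₂ (i≡n , _) = inj₂ (cong suc i≡n , refl)
... | suc k | inj₁ (i<n , e) = inj₁ (s≤s i<n , cong suc e)
... | suc k | inj₂ (_ , ())

cnext-injective : ∀ {n} {i j : Fin (suc n)} → cnext i ≡ cnext j → i ≡ j
cnext-injective {i = i} {j} e with cnext-toℕ i | cnext-toℕ j
... | inj₁ (_ , ei) | inj₁ (_ , ej) = toℕ-injective (suc-injective (trans (sym ei) (trans (cong toℕ e) ej)))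
... | inj₁ (_ , ei) | inj₂ (_ , ej) with () ← trans (sym ei) (trans (cong toℕ e) (cong toℕ ej))
... | inj₂ (_ , ei) | inj₁ (_ , ej) with () ← trans (sym ej) (trans (cong toℕ (sym e)) (cong toℕ ei))
... | inj₂ (i≡n , _) | inj₂ (j≡n , _) = toℕ-injective (trans i≡n (sym j≡n))

toℕ-mod : ∀ {n} x → x < suc n → toℕ (x mod suc n) ≡ x
toℕ-mod x x<N = trans (toℕ-fromℕ< _) (m<n⇒m%n≡m x<N)

mod-toℕ : ∀ {n} (i : Fin (suc n)) → toℕ i mod suc n ≡ i
mod-toℕ i = toℕ-injective (toℕ-mod (toℕ i) (toℕ<n i))

cnext-mod : ∀ {n} x → x < suc n → cnext (x mod suc n) ≡ suc x mod suc n
cnext-mod {n} x x<N with cnext-toℕ (x mod suc n)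
... | inj₁ (x<n , e) = toℕ-injective (begin
  toℕ (cnext (x mod suc n)) ≡⟨ e ⟩
  suc (toℕ (x mod suc n))   ≡⟨ cong suc (toℕ-mod x x<N) ⟩
  suc x                     ≡⟨ toℕ-mod (suc x) (s≤s (subst (_< n) (toℕ-mod x x<N) x<n)) ⟨
  toℕ (suc x mod suc n)     ∎)
  where open ≡-Reasoning
... | inj₂ (x≡n , z) = toℕ-injective (begin
  toℕ (cnext (x mod suc n)) ≡⟨ cong toℕ z ⟩
  0                         ≡⟨ n%n≡0 (suc n) ⟨
  suc n % suc n             ≡⟨ cong (λ y → suc y % suc n) (trans (sym (toℕ-mod x x<N)) x≡n) ⟨
  suc x % suc n             ≡⟨ toℕ-fromℕ< _ ⟨
  toℕ (suc x mod suc n)     ∎)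
  where open ≡-Reasoning

N-mod : ∀ {n} → suc n mod suc n ≡ zero
N-mod {n} = toℕ-injective (trans (toℕ-fromℕ< _) (n%n≡0 (suc n)))

module _ {A : Set} (_≟_ : DecidableEquality A) (P Q : A) where

  InPair : A → Set
  InPair w = w ≡ P ⊎ w ≡ Q

  pair-pigeonhole : ∀ {x y z} → x ≢ y → x ≢ z → y ≢ z →
    InPair x → InPair y → InPair z → ⊥
  pair-pigeonhole x≢y _ _ (inj₁ x≡P) (inj₁ y≡P) _ = x≢y (trans x≡P (sym y≡P))
  pair-pigeonhole x≢y _ _ (inj₂ x≡Q) (inj₂ y≡Q) _ = x≢y (trans x≡Q (sym y≡Q))
  pair-pigeonhole _ x≢z _ (inj₁ x≡P) _ (inj₁ z≡P) = x≢z (trans x≡P (sym z≡P))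
  pair-pigeonhole _ x≢z _ (inj₂ x≡Q) _ (inj₂ z≡Q) = x≢z (trans x≡Q (sym z≡Q))
  pair-pigeonhole _ _ y≢z _ (inj₁ y≡P) (inj₁ z≡P) = y≢z (trans y≡P (sym z≡P))
  pair-pigeonhole _ _ y≢z _ (inj₂ y≡Q) (inj₂ z≡Q) = y≢z (trans y≡Q (sym z≡Q))

  avoid-pair : (R : A → Set) {x y z : A} → x ≢ y → x ≢ z → y ≢ z →
    R x → R y → R z → Σ A λ w → R w × w ≢ P × w ≢ Q
  avoid-pair R {x} {y} {z} x≢y x≢z y≢z Rx Ry Rz
    with (x ≟ P) ⊎-dec (x ≟ Q) | (y ≟ P) ⊎-dec (y ≟ Q) | (z ≟ P) ⊎-dec (z ≟ Q)
  ... | no x∉ | _ | _ = x , Rx , x∉ ∘ inj₁ , x∉ ∘ inj₂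
  ... | yes _ | no y∉ | _ = y , Ry , y∉ ∘ inj₁ , y∉ ∘ inj₂
  ... | yes _ | yes _ | no z∉ = z , Rz , z∉ ∘ inj₁ , z∉ ∘ inj₂
  ... | yes x∈ | yes y∈ | yes z∈ = ⊥-elim (pair-pigeonhole x≢y x≢z y≢z x∈ y∈ z∈)

module HamiltonianLabelling {n : ℕ} (G : Graph (suc n)) (f : Fin (suc n) → Fin (suc n))
                            (ham : IsHamCycle G f) where

  private
    f-injective : Injective _≡_ _≡_ f
    f-injective = proj₁ (proj₁ (proj₂ ham))

    f-surjective : ∀ w → ∃ λ i → f i ≡ w
    f-surjective w with proj₂ (proj₁ (proj₂ ham)) w
    ... | i , fi≡w = i , fi≡w refl

  at : ℕ → Fin (suc n)
  at x = f (x mod suc n)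

  Edge : ℕ → ℕ → Set
  Edge x y = Adj G (at x) (at y)

  along : ∀ x → x < suc n → Edge x (suc x)
  along x x<N = subst (Adj G (at x) ∘ f) (cnext-mod x x<N) (proj₂ (proj₂ ham) (x mod suc n))

  at-injective : ∀ x y → at x ≡ at y → x % suc n ≡ y % suc n
  at-injective x y e =
    trans (sym (toℕ-fromℕ< _)) (trans (cong toℕ (f-injective e)) (toℕ-fromℕ< _))

  Cycle : ℕ → Set
  Cycle k = Σ (Fin k → Fin (suc n)) (IsCycle G k)

  cycle-of-labels : ∀ k (h : ℕ → ℕ) → 3 ≤ k →
    (∀ x y → x < k → y < k → h x % suc n ≡ h y % suc n → x ≡ y) →
    (∀ x → suc x < k → Edge (h x) (h (suc x))) →
    Edge (h (k ∸ 1)) (h 0) →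
    Cycle k
  cycle-of-labels (suc k) h 3≤k distinct steps closing =
    (λ i → at (h (toℕ i))) , 3≤k , injective , adjacent
    where
    injective : Injective _≡_ _≡_ (λ i → at (h (toℕ i)))
    injective {i} {j} e = toℕ-injective (distinct (toℕ i) (toℕ j) (toℕ<n i) (toℕ<n j)
      (at-injective (h (toℕ i)) (h (toℕ j)) e))
    adjacent : ∀ i → Edge (h (toℕ i)) (h (toℕ (cnext i)))
    adjacent i with cnext-toℕ i
    ... | inj₁ (i<k , e) rewrite e = steps (toℕ i) (s≤s i<k)
    ... | inj₂ (i≡k , z) rewrite z | i≡k = closing

  arc-cycle : ∀ d → 2 ≤ d → d < suc n → Edge 0 d → Cycle (suc d)
  arc-cycle d 2≤d d<N chord =
    cycle-of-labels (suc d) (λ x → x) (s≤s 2≤d) distinct step (adj-sym G chord)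
    where
    distinct : ∀ x y → x < suc d → y < suc d → x % suc n ≡ y % suc n → x ≡ y
    distinct x y x≤d y≤d = %-injective-below (≤-<-trans (≤-pred x≤d) d<N) (≤-<-trans (≤-pred y≤d) d<N)
    step : ∀ x → suc x < suc d → Edge x (suc x)
    step x x<d = along x (<-trans (≤-pred x<d) d<N)

  -- Read from its other side, a chord 0–d closes the arc d, d + 1, …, d + e = N
  -- (label N is vertex 0 again) into a cycle of length e + 1.
  wrap-cycle : ∀ d e → d + e ≡ suc n → 1 ≤ d → 2 ≤ e → Edge 0 d → Cycle (suc e)
  wrap-cycle d e d+e≡N 1≤d 2≤e chord =
    cycle-of-labels (suc e) (d +_) (s≤s 2≤e) distinct step closing
    where
    window : ∀ {x} → x < suc e → d + x ≤ suc n
    window {x} x≤e = subst (d + x ≤_) d+e≡N (+-monoʳ-≤ d (≤-pred x≤e))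
    distinct : ∀ x y → x < suc e → y < suc e → (d + x) % suc n ≡ (d + y) % suc n → x ≡ y
    distinct x y x≤e y≤e eq = +-cancelˡ-≡ d x y
      (%-injective-positive (≤-trans 1≤d (m≤m+n d x)) (window x≤e) (≤-trans 1≤d (m≤m+n d y)) (window y≤e) eq)
    step : ∀ x → suc x < suc e → Edge (d + x) (d + suc x)
    step x x<e = subst (Edge (d + x)) (sym (+-suc d x))
      (along (d + x) (subst (_≤ suc n) (+-suc d x) (window x<e)))
    closing : Edge (d + e) (d + 0)
    closing = subst₂ Edge (sym d+e≡N) (sym (+-identityʳ d))
      (subst (λ v → Adj G (f v) (at d)) (sym N-mod) chord)

  -- For B < d and d + B < N, the ladder walk visits the labels
  -- 0, 1, …, B, d + B, d + B - 1, …, d at the positions 0, 1, …, K = 2B + 1.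
  module Ladder (B d : ℕ) (B<d : B < d) (d+B<N : d + B < suc n) where

    K : ℕ
    K = B + suc B

    rung : ℕ → ℕ
    rung x with x ≤? B
    ... | yes _ = x
    ... | no _ = d + (K ∸ x)

    low<N : ∀ {x} → x ≤ B → x < suc n
    low<N x≤B = ≤-<-trans x≤B (<-trans B<d (≤-<-trans (m≤m+n d B) d+B<N))

    arms-apart : ∀ {x o} → x ≤ B → x ≢ d + o
    arms-apart {x} {o} x≤B x≡d+o = <⇒≱ (≤-<-trans x≤B B<d) (≤-trans (m≤m+n d o) (≤-reflexive (sym x≡d+o)))

    offset≤B : ∀ {x} → ¬ x ≤ B → K ∸ x ≤ B
    offset≤B x≰B = ≤-trans (∸-monoʳ-≤ K (≰⇒> x≰B)) (≤-reflexive (m+n∸n≡m B (suc B)))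

    high<N : ∀ {x} → ¬ x ≤ B → d + (K ∸ x) < suc n
    high<N x≰B = ≤-<-trans (+-monoʳ-≤ d (offset≤B x≰B)) d+B<N

    rung<N : ∀ x → rung x < suc n
    rung<N x with x ≤? B
    ... | yes x≤B = low<N x≤B
    ... | no x≰B = high<N x≰B

    rung-injective : ∀ x y → x ≤ K → y ≤ K → rung x ≡ rung y → x ≡ y
    rung-injective x y x≤K y≤K e with x ≤? B | y ≤? B
    ... | yes _ | yes _ = e
    ... | yes x≤B | no _ = ⊥-elim (arms-apart x≤B e)
    ... | no _ | yes y≤B = ⊥-elim (arms-apart y≤B (sym e))
    ... | no _ | no _ = ∸-cancelˡ-≡ x≤K y≤K (+-cancelˡ-≡ d _ _ e)

    descend : ∀ x → x < K → ¬ suc x ≤ B → Edge (d + (K ∸ x)) (d + (K ∸ suc x))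
    descend x x<K x≮B = subst (λ y → Edge y (d + (K ∸ suc x))) down
      (adj-sym G (along (d + (K ∸ suc x)) (high<N x≮B)))
      where
      down : suc (d + (K ∸ suc x)) ≡ d + (K ∸ x)
      down = trans (sym (+-suc d (K ∸ suc x))) (cong (d +_) (sym (+-∸-assoc 1 x<K)))

  ladder-cycle : ∀ B d → 1 ≤ B → B < d → d + B < suc n → Edge 0 d → Edge B (d + B) →
    Cycle (suc B + suc B)
  ladder-cycle B d 1≤B B<d d+B<N bottom top =
    cycle-of-labels (suc K) rung (s≤s (≤-trans (s≤s 1≤B) (m≤n+m (suc B) B))) distinct step closing
    where
    open Ladder B d B<d d+B<N

    distinct : ∀ x y → x < suc K → y < suc K → rung x % suc n ≡ rung y % suc n → x ≡ y
    distinct x y x≤K y≤K eq =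
      rung-injective x y (≤-pred x≤K) (≤-pred y≤K) (%-injective-below (rung<N x) (rung<N y) eq)

    -- Along the first arc, across the top rung, and down the second arc.
    step : ∀ x → suc x < suc K → Edge (rung x) (rung (suc x))
    step x x<K with suc x ≤? B | x ≤? B
    ... | yes x<B | yes _ = along x (low<N (<⇒≤ x<B))
    ... | yes x<B | no x≰B = ⊥-elim (x≰B (<⇒≤ x<B))
    ... | no x≮B | yes x≤B with ≤-antisym x≤B (≤-pred (≰⇒> x≮B))
    ...   | refl = subst (Edge x ∘ (d +_)) (sym (m+n∸n≡m B (suc B))) top
    step x x<K | no x≮B | no _ = descend x (≤-pred x<K) x≮B

    closing : Edge (rung K) (rung 0)
    closing with K ≤? B
    ... | yes K≤B = ⊥-elim (<⇒≱ (m≤n+m (suc B) B) K≤B)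
    ... | no _ = subst (λ y → Edge y 0) (sym (trans (cong (d +_) (n∸n≡0 K)) (+-identityʳ d))) (adj-sym G bottom)

  -- In a cubic graph every label has a chord: of its three neighbours at most two
  -- are its neighbours along the Hamiltonian cycle.
  chord-after : Cubic G → (p : Fin (suc n)) → Σ (Fin (suc n)) (IsChord G f (cnext p))
  chord-after cubic p with cubic (f (cnext p))
  ... | a , b , c , a≢b , a≢c , b≢c , adj-a , adj-b , adj-c , _
    with avoid-pair _≟ᶠ_ (f (cnext (cnext p))) (f p) (Adj G (f (cnext p))) a≢b a≢c b≢c adj-a adj-b adj-c
  ... | w , adj-w , w≢next , w≢prev with f-surjective w
  ... | u , refl = u , adj-w , w≢next ∘ cong f , w≢prev ∘ cong f ∘ cnext-injective

  -- Every label x < N has a chord; its predecessor is x - 1, or N - 1 when x = 0.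
  chord-at : Cubic G → ∀ x → x < suc n → Σ (Fin (suc n)) (IsChord G f (x mod suc n))
  chord-at cubic zero _ = subst (λ i → Σ (Fin (suc n)) (IsChord G f i))
    (trans (cnext-mod n ≤-refl) N-mod) (chord-after cubic (n mod suc n))
  chord-at cubic (suc x) x<N = subst (λ i → Σ (Fin (suc n)) (IsChord G f i))
    (cnext-mod x (<-trans (n<1+n x) x<N)) (chord-after cubic (x mod suc n))

  chord-edge : ∀ x {u} → IsChord G f (x mod suc n) u → Edge x (toℕ u)
  chord-edge x {u} (adj , _) = subst (Adj G (at x) ∘ f) (sym (mod-toℕ u)) adj

  chord-from-zero : ∀ {u} → IsChord G f zero u → 2 ≤ toℕ u × toℕ u < n
  chord-from-zero {u} (adj , u≢next , next≢0) =
    at-least-two not-zero not-one , ≤∧≢⇒< (≤-pred (toℕ<n u)) not-last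
    where
    at-least-two : ∀ {k} → k ≢ 0 → k ≢ 1 → 2 ≤ k
    at-least-two {zero} k≢0 _ = ⊥-elim (k≢0 refl)
    at-least-two {suc zero} _ k≢1 = ⊥-elim (k≢1 refl)
    at-least-two {suc (suc k)} _ _ = s≤s (s≤s z≤n)
    not-zero : toℕ u ≢ 0
    not-zero e = irrefl G (subst (Adj G (f zero) ∘ f) (toℕ-injective {j = zero} e) adj)
    not-one : toℕ u ≢ 1
    not-one e = u≢next (toℕ-injective (trans e (sym (trans (cong toℕ (cnext-mod 0 (s≤s z≤n)))
      (toℕ-mod 1 (≤-trans (s≤s (s≤s z≤n)) (proj₁ ham)))))))
    not-last : toℕ u ≢ n
    not-last e with cnext-toℕ u
    ... | inj₁ (u<n , _) = <-irrefl e u<n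
    ... | inj₂ (_ , z) = next≢0 z

  -- The chord offsets u_i - i are periodic with period B along the labels.
  PeriodicChords : ℕ → Set
  PeriodicChords B = ∀ i j u v → toℕ j < B → toℕ i ≡ toℕ j [mod B ] →
    IsChord G f i u → IsChord G f j v → (toℕ u + toℕ j) ≡ (toℕ v + toℕ i) [mod suc n ]

  translated-chord : Cubic G → ∀ B → 1 ≤ B → PeriodicChords B →
    ∀ {u} → IsChord G f zero u → toℕ u + B < suc n → Edge B (toℕ u + B)
  translated-chord cubic B 1≤B periodic {u} chord₀ d+B<N =
    subst (Edge B) chord-end (chord-edge B chord-B)
    where
    B<N : B < suc n
    B<N = ≤-<-trans (m≤n+m B (toℕ u)) d+B<N
    v : Fin (suc n)
    v = proj₁ (chord-at cubic B B<N)
    chord-B : IsChord G f (B mod suc n) v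
    chord-B = proj₂ (chord-at cubic B B<N)
    v+0<N : toℕ v + 0 < suc n
    v+0<N = subst (_< suc n) (sym (+-identityʳ (toℕ v))) (toℕ<n v)
    u+B<N : toℕ u + toℕ (B mod suc n) < suc n
    u+B<N = subst (λ b → toℕ u + b < suc n) (sym (toℕ-mod B B<N)) d+B<N
    B≡0 : toℕ (B mod suc n) ≡ 0 [mod B ]
    B≡0 = 1 , inj₂ (trans (+-identityʳ B) (sym (toℕ-mod B B<N)))
    chord-end : toℕ v ≡ toℕ u + B
    chord-end = begin
      toℕ v                       ≡⟨ +-identityʳ (toℕ v) ⟨
      toℕ v + 0                   ≡⟨ mod-unique v+0<N u+B<N
                                       (periodic (B mod suc n) zero v u 1≤B B≡0 chord-B chord₀) ⟩
      toℕ u + toℕ (B mod suc n)   ≡⟨ cong (toℕ u +_) (toℕ-mod B B<N) ⟩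
      toℕ u + B                   ∎
      where open ≡-Reasoning

  short-cycle : Cubic G → ∀ B → 1 ≤ B → PeriodicChords B → ∃ λ k → k ≤ suc B + suc B × Cycle k
  short-cycle cubic B 1≤B periodic with chord-at cubic 0 (s≤s z≤n)
  ... | u , chord₀ = by-cases (d ≤? suc B) (e ≤? suc B)
    where
    d e : ℕ
    d = toℕ u
    e = suc n ∸ d
    2≤d : 2 ≤ d
    2≤d = proj₁ (chord-from-zero chord₀)
    d<n : d < n
    d<n = proj₂ (chord-from-zero chord₀)
    d+e≡N : d + e ≡ suc n
    d+e≡N = m+[n∸m]≡n (<⇒≤ (<-trans d<n (n<1+n n)))
    2≤e : 2 ≤ e
    2≤e = +-cancelˡ-≤ d 2 e (subst (d + 2 ≤_) (sym d+e≡N) (subst (_≤ suc n) (+-comm 2 d) (s≤s d<n)))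
    base : Edge 0 d
    base = chord-edge 0 chord₀
    within : ∀ {k} → k ≤ suc (suc B) → k ≤ suc B + suc B
    within k≤ = ≤-trans k≤ (≤-trans (≤-reflexive (+-comm 1 (suc B))) (+-monoʳ-≤ (suc B) (s≤s z≤n)))
    by-cases : Dec (d ≤ suc B) → Dec (e ≤ suc B) → ∃ λ k → k ≤ suc B + suc B × Cycle k
    by-cases (yes d≤) _ = suc d , within (s≤s d≤) , arc-cycle d 2≤d (<-trans d<n (n<1+n n)) base
    by-cases (no _) (yes e≤) = suc e , within (s≤s e≤) ,
      wrap-cycle d e d+e≡N (≤-trans (s≤s z≤n) 2≤d) 2≤e base
    by-cases (no d≰) (no e≰) = suc B + suc B , ≤-refl ,
      ladder-cycle B d 1≤B B<d d+B<N base (translated-chord cubic B 1≤B periodic chord₀ d+B<N)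
      where
      B<d : B < d
      B<d = ≤-trans (n≤1+n (suc B)) (≰⇒> d≰)
      d+B<N : d + B < suc n
      d+B<N = subst (d + B <_) d+e≡N (+-monoʳ-< d (<-trans (n<1+n B) (≰⇒> e≰)))

ladder-length : ∀ b → suc (2 * b) + suc (2 * b) ≡ 4 * b + 2
ladder-length = solve-∀

theorem1 : (m b g : ℕ) (G : Graph (2 * m)) →
    Cubic G → Hamiltonian G → Bipartite G →
    HasSymmetryFactor m G b → HasGirth G g →
    g ≤ 4 * b + 2
theorem1 zero _ _ _ _ _ _ (_ , _ , (() , _) , _) _
theorem1 (suc m) zero _ _ _ _ _ (0∣m , _) _ with () ← 0∣⇒≡0 0∣m
theorem1 (suc m) (suc b) g G cubic _ _ (_ , f , ham , periodic) (_ , shortest)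
  with HamiltonianLabelling.short-cycle G f ham cubic (2 * suc b) (s≤s z≤n) periodic
... | k , k≤ , c , cycle = ≤-trans (shortest k c cycle) (≤-trans k≤ (≤-reflexive (ladder-length (suc b))))
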